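{- Let $\mathbf V$ be a nontrivial variety of closure algebras. If $B_{\mathtt F}\in\mathbf V$, then $\mathbf V$ does not have unitary unification.
   Context: A closure algebra is a Boolean algebra with a map $f$ satisfying $f(0)=0$, $f(a+b)=f(a)+f(b)$, $a\le f(a)$, $f(f(a))\le f(a)$. $B_{\mathtt F}$ is the complex algebra of the fork frame: power set of $\{u,v,w\}$ with $f(X)=\{x:\exists y\in X,\ x\mathrel Ry\}$, $R$ the reflexive closure of $\{(u,v),(u,w)\}$. An algebra $B\in\mathbf V$ is projective in $\mathbf V$ if for every $A\in\mathbf V$ and surjective homomorphism $p\colon A\to B$ there is a homomorphism $q\colon B\to A$ with $p\circ q=\mathrm{id}_B$. For a finite $A\in\mathbf V$, a unifier is a pair $(u,B)$ with $B\in\mathbf V$ finite and projective and $u\colon A\to B$ a homomorphism; $A$ is unifiable if it has one. $(u,B)\succcurlyeq(v,C)$ if there is a homomorphism $h\colon B\to C$ with $v=h\circ u$; $\approx$ is the induced equivalence. A $\mu$-set is an antichain $M$ of $\approx$-classes such that every unifier is $\preccurlyeq$ some element of $M$. $A$ has type $1$ if there is a $\mu$-set of size $1$. $\mathbf V$ has unitary unification if every unifiable finite $A\in\mathbf V$ has type $1$. -}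

module Defs where

open import Data.Bool using (Bool; true; false; _∨_; _∧_; not)
import Data.Bool.Properties as BP
open import Data.Nat using (ℕ)
open import Data.Fin using (Fin)
open import Data.Product using (Σ; Σ-syntax; ∃; ∃-syntax; _×_; _,_; proj₁; proj₂)
open import Data.Empty using (⊥)
open import Relation.Nullary using (¬_)
open import Relation.Binary.PropositionalEquality
  using (_≡_; refl; cong; cong₂; isEquivalence)
open import Function.Bundles using (_↔_)
open import Algebra.Core using (Op₁; Op₂)
open import Algebra.Lattice.Structures using (IsBooleanAlgebra)

record ClosureAlgebra : Set₁ where
  infixr 6 _⊔_
  infixr 7 _⊓_
  field
    Carrier          : Set
    _⊔_ _⊓_          : Op₂ Carrier
    ∼_               : Op₁ Carrier
    𝟙 𝟘              : Carrier
    isBooleanAlgebra : IsBooleanAlgebra _≡_ _⊔_ _⊓_ ∼_ 𝟙 𝟘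
    f                : Op₁ Carrier
    f-zero           : f 𝟘 ≡ 𝟘
    f-join           : ∀ a b → f (a ⊔ b) ≡ f a ⊔ f b
    -- a ≤ f a, where x ≤ y means x ⊔ y ≡ y
    f-extensive      : ∀ a → a ⊔ f a ≡ f a
    f-idem           : ∀ a → f (f a) ⊔ f a ≡ f a

open ClosureAlgebra public using (Carrier)

record Hom (A B : ClosureAlgebra) : Set where
  private
    module A = ClosureAlgebra A
    module B = ClosureAlgebra B
  field
    ⟦_⟧    : Carrier A → Carrier B
    pres-⊔ : ∀ x y → ⟦ x A.⊔ y ⟧ ≡ ⟦ x ⟧ B.⊔ ⟦ y ⟧
    pres-⊓ : ∀ x y → ⟦ x A.⊓ y ⟧ ≡ ⟦ x ⟧ B.⊓ ⟦ y ⟧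
    pres-∼ : ∀ x → ⟦ A.∼ x ⟧ ≡ B.∼ ⟦ x ⟧
    pres-𝟙 : ⟦ A.𝟙 ⟧ ≡ B.𝟙
    pres-𝟘 : ⟦ A.𝟘 ⟧ ≡ B.𝟘
    pres-f : ∀ x → ⟦ A.f x ⟧ ≡ B.f ⟦ x ⟧

open Hom public

Surjective : ∀ {A B} → Hom A B → Set
Surjective {A} {B} p = ∀ (b : Carrier B) → Σ[ a ∈ Carrier A ] ⟦ p ⟧ a ≡ b

Finite : ClosureAlgebra → Set
Finite A = Σ[ n ∈ ℕ ] (Carrier A ↔ Fin n)

data Term : Set where
  var       : ℕ → Term
  𝟘ₜ 𝟙ₜ     : Term
  _∨ₜ_ _∧ₜ_ : Term → Term → Term
  ¬ₜ_ fₜ_   : Term → Term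

eval : (A : ClosureAlgebra) → (ℕ → Carrier A) → Term → Carrier A
eval A ρ (var i)   = ρ i
eval A ρ 𝟘ₜ        = ClosureAlgebra.𝟘 A
eval A ρ 𝟙ₜ        = ClosureAlgebra.𝟙 A
eval A ρ (s ∨ₜ t)  = ClosureAlgebra._⊔_ A (eval A ρ s) (eval A ρ t)
eval A ρ (s ∧ₜ t)  = ClosureAlgebra._⊓_ A (eval A ρ s) (eval A ρ t)
eval A ρ (¬ₜ t)    = ClosureAlgebra.∼_ A (eval A ρ t)
eval A ρ (fₜ t)    = ClosureAlgebra.f A (eval A ρ t)

Equation : Set
Equation = Term × Term

_⊨_ : ClosureAlgebra → Equation → Set
A ⊨ (s , t) = ∀ (ρ : ℕ → Carrier A) → eval A ρ s ≡ eval A ρ t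

record Variety : Set₁ where
  field
    Eqs : Equation → Set

_∈_ : ClosureAlgebra → Variety → Set
A ∈ V = ∀ e → Variety.Eqs V e → A ⊨ e

Nontrivial : Variety → Set₁
Nontrivial V = Σ[ A ∈ ClosureAlgebra ] (A ∈ V × ¬ (ClosureAlgebra.𝟘 A ≡ ClosureAlgebra.𝟙 A))

Projective : Variety → ClosureAlgebra → Set₁
Projective V B =
  ∀ (A : ClosureAlgebra) → A ∈ V → (p : Hom A B) → Surjective p →
  Σ[ q ∈ Hom B A ] (∀ b → ⟦ p ⟧ (⟦ q ⟧ b) ≡ b)

record Unifier (V : Variety) (A : ClosureAlgebra) : Set₁ where
  field
    Tgt        : ClosureAlgebra
    Tgt∈V      : Tgt ∈ V
    Tgt-finite : Finite Tgt
    Tgt-proj   : Projective V Tgt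
    u          : Hom A Tgt

open Unifier public

_≽_ : ∀ {V A} → Unifier V A → Unifier V A → Set
_≽_ {A = A} U W =
  Σ[ h ∈ Hom (Tgt U) (Tgt W) ] (∀ (a : Carrier A) → ⟦ u W ⟧ a ≡ ⟦ h ⟧ (⟦ u U ⟧ a))

Unifiable : Variety → ClosureAlgebra → Set₁
Unifiable V A = Unifier V A

-- A μ-set of size k, given by representatives M i of its ≈-classes:
-- the classes are pairwise distinct and incomparable (antichain), and
-- every unifier is ≼ some element.
IsMuSet : ∀ {V A} {k : ℕ} → (Fin k → Unifier V A) → Set₁
IsMuSet {V} {A} {k} M =
  (∀ i j → ¬ (i ≡ j) → ¬ (M i ≽ M j)) ×
  (∀ (W : Unifier V A) → Σ[ i ∈ Fin k ] (M i ≽ W))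

HasType1 : Variety → ClosureAlgebra → Set₁
HasType1 V A = Σ[ M ∈ (Fin 1 → Unifier V A) ] IsMuSet M

UnitaryUnification : Variety → Set₁
UnitaryUnification V =
  ∀ (A : ClosureAlgebra) → A ∈ V → Finite A → Unifiable V A → HasType1 V A

-- The fork frame algebra B_F: subsets of {u, v, w} as triples of Bool
-- (membership of u, v, w); R is the reflexive closure of {(u,v),(u,w)},
-- so f(X) = { x | ∃ y ∈ X, x R y } is computed below.

T3 : Set
T3 = Bool × Bool × Bool

tri : ∀ {a a' b b' c c' : Bool} → a ≡ a' → b ≡ b' → c ≡ c' →
      (a , b , c) ≡ (a' , b' , c')
tri refl refl refl = refl

_∨₃_ _∧₃_ : Op₂ T3
(a , b , c) ∨₃ (a' , b' , c') = (a ∨ a' , b ∨ b' , c ∨ c')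
(a , b , c) ∧₃ (a' , b' , c') = (a ∧ a' , b ∧ b' , c ∧ c')

not₃ : Op₁ T3
not₃ (a , b , c) = (not a , not b , not c)

top₃ bot₃ : T3
top₃ = (true , true , true)
bot₃ = (false , false , false)

fork : Op₁ T3
fork (a , b , c) = (a ∨ b ∨ c , b , c)

private
  module BB = IsBooleanAlgebra BP.∨-∧-isBooleanAlgebra

  isBA₃ : IsBooleanAlgebra _≡_ _∨₃_ _∧₃_ not₃ top₃ bot₃
  isBA₃ = record
    { isDistributiveLattice = record
      { isLattice = record
        { isEquivalence = isEquivalence
        ; ∨-comm  = λ { (a , b , c) (x , y , z) → tri (BP.∨-comm a x) (BP.∨-comm b y) (BP.∨-comm c z) }
        ; ∨-assoc = λ { (a , b , c) (x , y , z) (p , q , r) → tri (BP.∨-assoc a x p) (BP.∨-assoc b y q) (BP.∨-assoc c z r) }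
        ; ∨-cong  = λ { refl refl → refl }
        ; ∧-comm  = λ { (a , b , c) (x , y , z) → tri (BP.∧-comm a x) (BP.∧-comm b y) (BP.∧-comm c z) }
        ; ∧-assoc = λ { (a , b , c) (x , y , z) (p , q , r) → tri (BP.∧-assoc a x p) (BP.∧-assoc b y q) (BP.∧-assoc c z r) }
        ; ∧-cong  = λ { refl refl → refl }
        ; absorptive =
            (λ { (a , b , c) (x , y , z) → tri (BB.∨-absorbs-∧ a x) (BB.∨-absorbs-∧ b y) (BB.∨-absorbs-∧ c z) }) ,
            (λ { (a , b , c) (x , y , z) → tri (BB.∧-absorbs-∨ a x) (BB.∧-absorbs-∨ b y) (BB.∧-absorbs-∨ c z) })
        }
      ; ∨-distrib-∧ =
          (λ { (a , b , c) (x , y , z) (p , q , r) → tri (BB.∨-distribˡ-∧ a x p) (BB.∨-distribˡ-∧ b y q) (BB.∨-distribˡ-∧ c z r) }) ,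
          (λ { (a , b , c) (x , y , z) (p , q , r) → tri (BB.∨-distribʳ-∧ a x p) (BB.∨-distribʳ-∧ b y q) (BB.∨-distribʳ-∧ c z r) })
      ; ∧-distrib-∨ =
          (λ { (a , b , c) (x , y , z) (p , q , r) → tri (BB.∧-distribˡ-∨ a x p) (BB.∧-distribˡ-∨ b y q) (BB.∧-distribˡ-∨ c z r) }) ,
          (λ { (a , b , c) (x , y , z) (p , q , r) → tri (BB.∧-distribʳ-∨ a x p) (BB.∧-distribʳ-∨ b y q) (BB.∧-distribʳ-∨ c z r) })
      }
    ; ∨-complement =
        (λ { (a , b , c) → tri (BB.∨-complementˡ a) (BB.∨-complementˡ b) (BB.∨-complementˡ c) }) ,
        (λ { (a , b , c) → tri (BB.∨-complementʳ a) (BB.∨-complementʳ b) (BB.∨-complementʳ c) })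
    ; ∧-complement =
        (λ { (a , b , c) → tri (BB.∧-complementˡ a) (BB.∧-complementˡ b) (BB.∧-complementˡ c) }) ,
        (λ { (a , b , c) → tri (BB.∧-complementʳ a) (BB.∧-complementʳ b) (BB.∧-complementʳ c) })
    ; ¬-cong = λ { refl → refl }
    }

  fork-join : ∀ X Y → fork (X ∨₃ Y) ≡ fork X ∨₃ fork Y
  fork-join (false , false , false) (x , y , z) = refl
  fork-join (false , false , true) (true , y , z) = refl
  fork-join (false , false , true) (false , y , z) = tri (BP.∨-zeroʳ y) refl refl
  fork-join (false , true , c) (true , y , z) = refl
  fork-join (false , true , c) (false , y , z) = refl
  fork-join (true , b , c) (x , y , z) = refl

  fork-ext : ∀ X → X ∨₃ fork X ≡ fork X
  fork-ext (false , b , c) = tri refl (BP.∨-idem b) (BP.∨-idem c)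
  fork-ext (true , b , c) = tri refl (BP.∨-idem b) (BP.∨-idem c)

  fork-idem : ∀ X → fork (fork X) ∨₃ fork X ≡ fork X
  fork-idem (true , b , c) = tri refl (BP.∨-idem b) (BP.∨-idem c)
  fork-idem (false , true , c) = tri refl refl (BP.∨-idem c)
  fork-idem (false , false , true) = refl
  fork-idem (false , false , false) = refl

B-F : ClosureAlgebra
B-F = record
  { Carrier = T3
  ; _⊔_ = _∨₃_ ; _⊓_ = _∧₃_ ; ∼_ = not₃ ; 𝟙 = top₃ ; 𝟘 = bot₃
  ; isBooleanAlgebra = isBA₃
  ; f = fork
  ; f-zero = refl
  ; f-join = fork-join
  ; f-extensive = fork-ext
  ; f-idem = fork-idem
  }

{-# OPTIONS --safe #-}
-- Two² = 2 × 2 with the identity closure is a quotient of B-F (restriction to {v, w}), and its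
-- two projections onto 2 are unifiers with projective target 2.  A single most general unifier
-- (u , B) would factor both of them through maps B → 2.  As B is projective, the induced map
-- B → Two² lifts along the surjection B-F → Two² (via the pullback, a subalgebra of a product
-- and hence in V), and composing with u gives a homomorphism Two² → B-F splitting the
-- restriction.  There is none: it would send {v} and {w} to disjoint closed sets of the fork,
-- but every closed set meeting {v, w} contains the root u.
module Submission where

open import Defs
open import Relation.Nullary using (¬_)
open import Algebra.Lattice using (IsBooleanAlgebra; isBooleanAlgebraʳ; isDistributiveLatticeʳʲᵐ; BooleanAlgebra)
import Algebra.Lattice.Properties.BooleanAlgebra as BooleanAlgebraProperties
open import Data.Bool using (Bool; true; false; _∨_; _∧_; not)
import Data.Bool.Properties as BP
open import Data.Fin using (zero)
open import Data.Fin.Properties using (2↔Bool; *↔×)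
open import Data.Irrelevant using ([_]; zipWith)
import Data.Irrelevant as Irrelevant
open import Data.Nat using (ℕ; _*_)
open import Data.Product using (Σ-syntax; _×_; _,_; proj₁; proj₂; uncurry; map; zip′)
open import Data.Product.Function.NonDependent.Propositional using (_×-↔_)
open import Data.Product.Properties using (≡-dec)
open import Data.Refinement using (Refinement-syntax; _,_; value; proof; value-injective)
open import Function.Base using (_∘_)
open import Function.Definitions using (Injective)
open import Function.Properties.Inverse using (↔-sym; ↔-trans)
open import Relation.Binary.Definitions using (DecidableEquality)
open import Relation.Binary.PropositionalEquality
  using (_≡_; refl; sym; trans; cong; cong₂; isEquivalence; module ≡-Reasoning)
open import Relation.Nullary.Decidable using (recompute)

private
  variable
    A B C : ClosureAlgebra

booleanAlgebra : ClosureAlgebra → BooleanAlgebra _ _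
booleanAlgebra A = record { isBooleanAlgebra = ClosureAlgebra.isBooleanAlgebra A }

f-𝟙 : (A : ClosureAlgebra) → let open ClosureAlgebra A in f 𝟙 ≡ 𝟙
f-𝟙 A = trans (sym (f-extensive 𝟙)) (∨-zeroˡ (f 𝟙))
  where
  open ClosureAlgebra A
  open BooleanAlgebraProperties (booleanAlgebra A)

_∘ₕ_ : Hom B C → Hom A B → Hom A C
g ∘ₕ h = record
  { ⟦_⟧    = λ x → ⟦ g ⟧ (⟦ h ⟧ x)
  ; pres-⊔ = λ x y → trans (cong ⟦ g ⟧ (pres-⊔ h x y)) (pres-⊔ g _ _)
  ; pres-⊓ = λ x y → trans (cong ⟦ g ⟧ (pres-⊓ h x y)) (pres-⊓ g _ _)
  ; pres-∼ = λ x → trans (cong ⟦ g ⟧ (pres-∼ h x)) (pres-∼ g _)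
  ; pres-𝟙 = trans (cong ⟦ g ⟧ (pres-𝟙 h)) (pres-𝟙 g)
  ; pres-𝟘 = trans (cong ⟦ g ⟧ (pres-𝟘 h)) (pres-𝟘 g)
  ; pres-f = λ x → trans (cong ⟦ g ⟧ (pres-f h x)) (pres-f g _)
  }

eval-hom : (h : Hom A B) {ρ : ℕ → Carrier A} {σ : ℕ → Carrier B} →
           (∀ i → ⟦ h ⟧ (ρ i) ≡ σ i) → ∀ t → ⟦ h ⟧ (eval A ρ t) ≡ eval B σ t
eval-hom h hρ (var i)  = hρ i
eval-hom h hρ 𝟘ₜ       = pres-𝟘 h
eval-hom h hρ 𝟙ₜ       = pres-𝟙 h
eval-hom {B = B} h hρ (s ∨ₜ t) =
  trans (pres-⊔ h _ _) (cong₂ (ClosureAlgebra._⊔_ B) (eval-hom h hρ s) (eval-hom h hρ t))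
eval-hom {B = B} h hρ (s ∧ₜ t) =
  trans (pres-⊓ h _ _) (cong₂ (ClosureAlgebra._⊓_ B) (eval-hom h hρ s) (eval-hom h hρ t))
eval-hom {B = B} h hρ (¬ₜ t) = trans (pres-∼ h _) (cong (ClosureAlgebra.∼_ B) (eval-hom h hρ t))
eval-hom {B = B} h hρ (fₜ t) = trans (pres-f h _) (cong (ClosureAlgebra.f B) (eval-hom h hρ t))

∈-image : (V : Variety) → A ∈ V → (h : Hom A B) → Surjective h → B ∈ V
∈-image {A = A} V A∈V h h-onto e@(s , t) e∈V ρ = begin
  eval _ ρ s                  ≡⟨ eval-hom h hits s ⟨
  ⟦ h ⟧ (eval A preimage s)   ≡⟨ cong ⟦ h ⟧ (A∈V e e∈V preimage) ⟩
  ⟦ h ⟧ (eval A preimage t)   ≡⟨ eval-hom h hits t ⟩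
  eval _ ρ t                  ∎
  where
  open ≡-Reasoning
  preimage : ℕ → Carrier A
  preimage i = proj₁ (h-onto (ρ i))
  hits : ∀ i → ⟦ h ⟧ (preimage i) ≡ ρ i
  hits i = proj₂ (h-onto (ρ i))

∈-embedded : (V : Variety) → B ∈ V → (h : Hom A B) → Injective _≡_ _≡_ ⟦ h ⟧ → A ∈ V
∈-embedded {B = B} V B∈V h h-inj e@(s , t) e∈V ρ = h-inj (begin
  ⟦ h ⟧ (eval _ ρ s)    ≡⟨ eval-hom h (λ _ → refl) s ⟩
  eval B (⟦ h ⟧ ∘ ρ) s  ≡⟨ B∈V e e∈V (⟦ h ⟧ ∘ ρ) ⟩
  eval B (⟦ h ⟧ ∘ ρ) t  ≡⟨ eval-hom h (λ _ → refl) t ⟨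
  ⟦ h ⟧ (eval _ ρ t)    ∎)
  where
  open ≡-Reasoning

infixr 2 _×ᶜ_
_×ᶜ_ : ClosureAlgebra → ClosureAlgebra → ClosureAlgebra
A ×ᶜ B = record
  { Carrier = Carrier A × Carrier B
  ; _⊔_ = zip′ A._⊔_ B._⊔_ ; _⊓_ = zip′ A._⊓_ B._⊓_ ; ∼_ = map A.∼_ B.∼_
  ; 𝟙 = A.𝟙 , B.𝟙 ; 𝟘 = A.𝟘 , B.𝟘
  ; isBooleanAlgebra = isBooleanAlgebraʳ (record
    { isDistributiveLattice = isDistributiveLatticeʳʲᵐ (record
      { isLattice = record
        { isEquivalence = isEquivalence
        ; ∨-comm  = λ x y → cong₂ _,_ (A.∨-comm _ _) (B.∨-comm _ _)
        ; ∨-assoc = λ x y z → cong₂ _,_ (A.∨-assoc _ _ _) (B.∨-assoc _ _ _)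
        ; ∨-cong  = cong₂ (zip′ A._⊔_ B._⊔_)
        ; ∧-comm  = λ x y → cong₂ _,_ (A.∧-comm _ _) (B.∧-comm _ _)
        ; ∧-assoc = λ x y z → cong₂ _,_ (A.∧-assoc _ _ _) (B.∧-assoc _ _ _)
        ; ∧-cong  = cong₂ (zip′ A._⊓_ B._⊓_)
        ; absorptive =
            (λ x y → cong₂ _,_ (A.∨-absorbs-∧ _ _) (B.∨-absorbs-∧ _ _)) ,
            (λ x y → cong₂ _,_ (A.∧-absorbs-∨ _ _) (B.∧-absorbs-∨ _ _))
        }
      ; ∨-distribʳ-∧ = λ x y z → cong₂ _,_ (A.∨-distribʳ-∧ _ _ _) (B.∨-distribʳ-∧ _ _ _)
      })
    ; ∨-complementʳ = λ x → cong₂ _,_ (A.∨-complementʳ _) (B.∨-complementʳ _)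
    ; ∧-complementʳ = λ x → cong₂ _,_ (A.∧-complementʳ _) (B.∧-complementʳ _)
    ; ¬-cong = cong (map A.∼_ B.∼_)
    })
  ; f = map A.f B.f
  ; f-zero = cong₂ _,_ A.f-zero B.f-zero
  ; f-join = λ x y → cong₂ _,_ (A.f-join _ _) (B.f-join _ _)
  ; f-extensive = λ x → cong₂ _,_ (A.f-extensive _) (B.f-extensive _)
  ; f-idem = λ x → cong₂ _,_ (A.f-idem _) (B.f-idem _)
  }
  where
  module A where
    open ClosureAlgebra A public
    open IsBooleanAlgebra isBooleanAlgebra public
  module B where
    open ClosureAlgebra B public
    open IsBooleanAlgebra isBooleanAlgebra public

π₁ : Hom (A ×ᶜ B) A
π₁ = record
  { ⟦_⟧ = proj₁ ; pres-⊔ = λ _ _ → refl ; pres-⊓ = λ _ _ → refl ; pres-∼ = λ _ → refl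
  ; pres-𝟙 = refl ; pres-𝟘 = refl ; pres-f = λ _ → refl }

π₂ : Hom (A ×ᶜ B) B
π₂ = record
  { ⟦_⟧ = proj₂ ; pres-⊔ = λ _ _ → refl ; pres-⊓ = λ _ _ → refl ; pres-∼ = λ _ → refl
  ; pres-𝟙 = refl ; pres-𝟘 = refl ; pres-f = λ _ → refl }

⟨_,_⟩ₕ : Hom C A → Hom C B → Hom C (A ×ᶜ B)
⟨ g , h ⟩ₕ = record
  { ⟦_⟧    = λ x → ⟦ g ⟧ x , ⟦ h ⟧ x
  ; pres-⊔ = λ x y → cong₂ _,_ (pres-⊔ g x y) (pres-⊔ h x y)
  ; pres-⊓ = λ x y → cong₂ _,_ (pres-⊓ g x y) (pres-⊓ h x y)
  ; pres-∼ = λ x → cong₂ _,_ (pres-∼ g x) (pres-∼ h x)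
  ; pres-𝟙 = cong₂ _,_ (pres-𝟙 g) (pres-𝟙 h)
  ; pres-𝟘 = cong₂ _,_ (pres-𝟘 g) (pres-𝟘 h)
  ; pres-f = λ x → cong₂ _,_ (pres-f g x) (pres-f h x)
  }

∈-×ᶜ : (V : Variety) → A ∈ V → B ∈ V → (A ×ᶜ B) ∈ V
∈-×ᶜ {A = A} {B = B} V A∈V B∈V e@(s , t) e∈V ρ = begin
  eval (A ×ᶜ B) ρ s                             ≡⟨ components s ⟩
  eval A (proj₁ ∘ ρ) s , eval B (proj₂ ∘ ρ) s   ≡⟨ cong₂ _,_ (A∈V e e∈V (proj₁ ∘ ρ)) (B∈V e e∈V (proj₂ ∘ ρ)) ⟩
  eval A (proj₁ ∘ ρ) t , eval B (proj₂ ∘ ρ) t   ≡⟨ components t ⟨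
  eval (A ×ᶜ B) ρ t                             ∎
  where
  open ≡-Reasoning
  components : ∀ r → eval (A ×ᶜ B) ρ r ≡ (eval A (proj₁ ∘ ρ) r , eval B (proj₂ ∘ ρ) r)
  components r = cong₂ _,_ (eval-hom (π₁ {B = B}) (λ _ → refl) r) (eval-hom (π₂ {A = A}) (λ _ → refl) r)

×ᶜ-finite : Finite A → Finite B → Finite (A ×ᶜ B)
×ᶜ-finite (m , A↔m) (n , B↔n) = m * n , ↔-trans (A↔m ×-↔ B↔n) (↔-sym *↔×)

record IsSubuniverse (A : ClosureAlgebra) (P : Carrier A → Set) : Set where
  open ClosureAlgebra A
  field
    ⊔-closed : ∀ {x y} → P x → P y → P (x ⊔ y)
    ⊓-closed : ∀ {x y} → P x → P y → P (x ⊓ y)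
    ∼-closed : ∀ {x} → P x → P (∼ x)
    𝟙-closed : P 𝟙
    𝟘-closed : P 𝟘
    f-closed : ∀ {x} → P x → P (f x)

Subalgebra : (A : ClosureAlgebra) {P : Carrier A → Set} → IsSubuniverse A P → ClosureAlgebra
Subalgebra A {P} S = record
  { Carrier = [ x ∈ Carrier A ∣ P x ]
  ; _⊔_ = λ x y → value x A.⊔ value y , zipWith ⊔-closed (proof x) (proof y)
  ; _⊓_ = λ x y → value x A.⊓ value y , zipWith ⊓-closed (proof x) (proof y)
  ; ∼_ = λ x → A.∼ value x , Irrelevant.map ∼-closed (proof x)
  ; 𝟙 = A.𝟙 , [ 𝟙-closed ]
  ; 𝟘 = A.𝟘 , [ 𝟘-closed ]
  ; isBooleanAlgebra = isBooleanAlgebraʳ (record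
    { isDistributiveLattice = isDistributiveLatticeʳʲᵐ (record
      { isLattice = record
        { isEquivalence = isEquivalence
        ; ∨-comm  = λ x y → value-injective (A.∨-comm (value x) (value y))
        ; ∨-assoc = λ x y z → value-injective (A.∨-assoc (value x) (value y) (value z))
        ; ∨-cong  = λ { refl refl → refl }
        ; ∧-comm  = λ x y → value-injective (A.∧-comm (value x) (value y))
        ; ∧-assoc = λ x y z → value-injective (A.∧-assoc (value x) (value y) (value z))
        ; ∧-cong  = λ { refl refl → refl }
        ; absorptive =
            (λ x y → value-injective (A.∨-absorbs-∧ (value x) (value y))) ,
            (λ x y → value-injective (A.∧-absorbs-∨ (value x) (value y)))
        }
      ; ∨-distribʳ-∧ = λ x y z → value-injective (A.∨-distribʳ-∧ (value x) (value y) (value z))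
      })
    ; ∨-complementʳ = λ x → value-injective (A.∨-complementʳ (value x))
    ; ∧-complementʳ = λ x → value-injective (A.∧-complementʳ (value x))
    ; ¬-cong = λ { refl → refl }
    })
  ; f = λ x → A.f (value x) , Irrelevant.map f-closed (proof x)
  ; f-zero = value-injective A.f-zero
  ; f-join = λ x y → value-injective (A.f-join (value x) (value y))
  ; f-extensive = λ x → value-injective (A.f-extensive (value x))
  ; f-idem = λ x → value-injective (A.f-idem (value x))
  }
  where
  open IsSubuniverse S
  module A where
    open ClosureAlgebra A public
    open IsBooleanAlgebra isBooleanAlgebra public

incl : {P : Carrier A → Set} {S : IsSubuniverse A P} → Hom (Subalgebra A S) A
incl = record
  { ⟦_⟧ = value ; pres-⊔ = λ _ _ → refl ; pres-⊓ = λ _ _ → refl ; pres-∼ = λ _ → refl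
  ; pres-𝟙 = refl ; pres-𝟘 = refl ; pres-f = λ _ → refl }

module _ (p : Hom A C) (h : Hom B C) where
  open ClosureAlgebra C using (_⊔_; _⊓_; ∼_; f)

  Agree : Carrier (B ×ᶜ A) → Set
  Agree (b , a) = ⟦ h ⟧ b ≡ ⟦ p ⟧ a

  agree-subuniverse : IsSubuniverse (B ×ᶜ A) Agree
  agree-subuniverse = record
    { ⊔-closed = λ e e′ → trans (pres-⊔ h _ _) (trans (cong₂ _⊔_ e e′) (sym (pres-⊔ p _ _)))
    ; ⊓-closed = λ e e′ → trans (pres-⊓ h _ _) (trans (cong₂ _⊓_ e e′) (sym (pres-⊓ p _ _)))
    ; ∼-closed = λ e → trans (pres-∼ h _) (trans (cong ∼_ e) (sym (pres-∼ p _)))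
    ; 𝟙-closed = trans (pres-𝟙 h) (sym (pres-𝟙 p))
    ; 𝟘-closed = trans (pres-𝟘 h) (sym (pres-𝟘 p))
    ; f-closed = λ e → trans (pres-f h _) (trans (cong f e) (sym (pres-f p _)))
    }

  Pullback : ClosureAlgebra
  Pullback = Subalgebra (B ×ᶜ A) agree-subuniverse

-- The pullback stores the equation ⟦ h ⟧ b ≡ ⟦ p ⟧ a irrelevantly, so that
-- it is a subalgebra of B ×ᶜ A; decidable equality on C recovers it.
lift-along-surjection : (V : Variety) → Projective V B → B ∈ V → A ∈ V →
                        DecidableEquality (Carrier C) →
                        (p : Hom A C) → Surjective p → (h : Hom B C) →
                        Σ[ g ∈ Hom B A ] (∀ x → ⟦ p ⟧ (⟦ g ⟧ x) ≡ ⟦ h ⟧ x)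
lift-along-surjection {B = B} {A = A} V B-projective B∈V A∈V _≟_ p p-onto h =
  π₂ {A = B} ∘ₕ (incl ∘ₕ q) , lifts
  where
  open ≡-Reasoning
  P = Pullback p h

  P∈V : P ∈ V
  P∈V = ∈-embedded V (∈-×ᶜ V B∈V A∈V) incl value-injective

  toB : Hom P B
  toB = π₁ {B = A} ∘ₕ incl

  toB-onto : Surjective toB
  toB-onto b = ((b , proj₁ (p-onto (⟦ h ⟧ b))) , [ sym (proj₂ (p-onto (⟦ h ⟧ b))) ]) , refl

  q : Hom B P
  q = proj₁ (B-projective P P∈V toB toB-onto)

  q-section : ∀ x → ⟦ toB ⟧ (⟦ q ⟧ x) ≡ x
  q-section = proj₂ (B-projective P P∈V toB toB-onto)

  agreement : ∀ z → Agree p h (value z)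
  agreement (_ , [ e ]) = recompute (_ ≟ _) e

  lifts : ∀ x → ⟦ p ⟧ (proj₂ (value (⟦ q ⟧ x))) ≡ ⟦ h ⟧ x
  lifts x = begin
    ⟦ p ⟧ (proj₂ (value (⟦ q ⟧ x)))  ≡⟨ agreement (⟦ q ⟧ x) ⟨
    ⟦ h ⟧ (proj₁ (value (⟦ q ⟧ x)))  ≡⟨ cong ⟦ h ⟧ (q-section x) ⟩
    ⟦ h ⟧ x                          ∎

Two : ClosureAlgebra
Two = record
  { Carrier = Bool
  ; _⊔_ = _∨_ ; _⊓_ = _∧_ ; ∼_ = not ; 𝟙 = true ; 𝟘 = false
  ; isBooleanAlgebra = BP.∨-∧-isBooleanAlgebra
  ; f = λ x → x
  ; f-zero = refl
  ; f-join = λ _ _ → refl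
  ; f-extensive = BP.∨-idem
  ; f-idem = BP.∨-idem
  }

Two-finite : Finite Two
Two-finite = 2 , ↔-sym 2↔Bool

Two-initial : (A : ClosureAlgebra) → Hom Two A
Two-initial A = record
  { ⟦_⟧    = embed
  ; pres-⊔ = λ { true y → sym (∨-zeroˡ (embed y)) ; false y → sym (∨-identityˡ (embed y)) }
  ; pres-⊓ = λ { true y → sym (∧-identityˡ (embed y)) ; false y → sym (∧-zeroˡ (embed y)) }
  ; pres-∼ = λ { true → sym ¬⊤≈⊥ ; false → sym ¬⊥≈⊤ }
  ; pres-𝟙 = refl
  ; pres-𝟘 = refl
  ; pres-f = λ { true → sym (f-𝟙 A) ; false → sym f-zero }
  }
  where
  open ClosureAlgebra A
  open BooleanAlgebraProperties (booleanAlgebra A)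
  embed : Bool → Carrier A
  embed true  = 𝟙
  embed false = 𝟘

Two-projective : (V : Variety) → Projective V Two
Two-projective V A _ p _ = Two-initial A , λ { true → pres-𝟙 p ; false → pres-𝟘 p }

Two² : ClosureAlgebra
Two² = Two ×ᶜ Two

Two²-finite : Finite Two²
Two²-finite = ×ᶜ-finite {A = Two} {B = Two} Two-finite Two-finite

diagonal : Hom Two B-F
diagonal = record
  { ⟦_⟧ = λ x → x , x , x ; pres-⊔ = λ _ _ → refl ; pres-⊓ = λ _ _ → refl ; pres-∼ = λ _ → refl
  ; pres-𝟙 = refl ; pres-𝟘 = refl ; pres-f = λ { true → refl ; false → refl } }

-- Restriction to {v, w}, on which the closure operator of the fork is the identity.
restrict-vw : Hom B-F Two²
restrict-vw = record
  { ⟦_⟧ = proj₂ ; pres-⊔ = λ _ _ → refl ; pres-⊓ = λ _ _ → refl ; pres-∼ = λ _ → refl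
  ; pres-𝟙 = refl ; pres-𝟘 = refl ; pres-f = λ _ → refl }

restrict-vw-onto : Surjective restrict-vw
restrict-vw-onto x = (false , x) , refl

Two∈V : (V : Variety) → B-F ∈ V → Two ∈ V
Two∈V V BF∈V = ∈-embedded V BF∈V diagonal (cong proj₁)

Two²∈V : (V : Variety) → B-F ∈ V → Two² ∈ V
Two²∈V V BF∈V = ∈-image V BF∈V restrict-vw restrict-vw-onto

closed∋v⇒closed∋u : (y : T3) → fork y ≡ y → proj₁ (proj₂ y) ≡ true → proj₁ y ≡ true
closed∋v⇒closed∋u (true  , _ , _)    _ _ = refl
closed∋v⇒closed∋u (false , true , _) e _ = cong proj₁ (sym e)

closed∋w⇒closed∋u : (y : T3) → fork y ≡ y → proj₂ (proj₂ y) ≡ true → proj₁ y ≡ true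
closed∋w⇒closed∋u (true  , _ , _)        _ _ = refl
closed∋w⇒closed∋u (false , true , _)     e _ = cong proj₁ (sym e)
closed∋w⇒closed∋u (false , false , true) e _ = cong proj₁ (sym e)

restrict-vw-has-no-section : (s : Hom Two² B-F) → ¬ (∀ x → ⟦ restrict-vw ⟧ (⟦ s ⟧ x) ≡ x)
restrict-vw-has-no-section s s-section = u∉s[v]∧s[w] (cong₂ _∧_ u∈s[v] u∈s[w])
  where
  closed : ∀ x → fork (⟦ s ⟧ x) ≡ ⟦ s ⟧ x
  closed x = sym (pres-f s x)

  u∈s[v] : proj₁ (⟦ s ⟧ (true , false)) ≡ true
  u∈s[v] = closed∋v⇒closed∋u _ (closed _) (cong proj₁ (s-section _))

  u∈s[w] : proj₁ (⟦ s ⟧ (false , true)) ≡ true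
  u∈s[w] = closed∋w⇒closed∋u _ (closed _) (cong proj₂ (s-section _))

  disjoint : ⟦ s ⟧ (true , false) ∧₃ ⟦ s ⟧ (false , true) ≡ bot₃
  disjoint = trans (sym (pres-⊓ s _ _)) (pres-𝟘 s)

  u∉s[v]∧s[w] : ¬ (proj₁ (⟦ s ⟧ (true , false)) ∧ proj₁ (⟦ s ⟧ (false , true)) ≡ true)
  u∉s[v]∧s[w] e with trans (sym (cong proj₁ disjoint)) e
  ... | ()

module _ (V : Variety) (BF∈V : B-F ∈ V) where

  projection-unifier : Hom Two² Two → Unifier V Two²
  projection-unifier π = record
    { Tgt = Two ; Tgt∈V = Two∈V V BF∈V ; Tgt-finite = Two-finite ; Tgt-proj = Two-projective V ; u = π }

  v-unifier w-unifier : Unifier V Two²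
  v-unifier = projection-unifier (π₁ {A = Two} {B = Two})
  w-unifier = projection-unifier (π₂ {A = Two} {B = Two})

  common-bound⇒section : (U : Unifier V Two²) → U ≽ v-unifier → U ≽ w-unifier →
                         Σ[ s ∈ Hom Two² B-F ] (∀ x → ⟦ restrict-vw ⟧ (⟦ s ⟧ x) ≡ x)
  common-bound⇒section U (h₁ , u≡h₁∘u) (h₂ , u≡h₂∘u) = proj₁ lift ∘ₕ u U , section
    where
    lift : Σ[ g ∈ Hom (Tgt U) B-F ] (∀ x → ⟦ restrict-vw ⟧ (⟦ g ⟧ x) ≡ ⟦ ⟨ h₁ , h₂ ⟩ₕ ⟧ x)
    lift = lift-along-surjection V (Tgt-proj U) (Tgt∈V U) BF∈V (≡-dec BP._≟_ BP._≟_)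
             restrict-vw restrict-vw-onto ⟨ h₁ , h₂ ⟩ₕ

    section : ∀ x → ⟦ restrict-vw ⟧ (⟦ proj₁ lift ⟧ (⟦ u U ⟧ x)) ≡ x
    section x = trans (proj₂ lift (⟦ u U ⟧ x)) (sym (cong₂ _,_ (u≡h₁∘u x) (u≡h₂∘u x)))

mainTheorem5 : (V : Variety) → Nontrivial V → B-F ∈ V → ¬ UnitaryUnification V
mainTheorem5 V _ BF∈V unitary
  with unitary Two² (Two²∈V V BF∈V) Two²-finite (v-unifier V BF∈V)
... | M , _ , covers
  with covers (v-unifier V BF∈V) | covers (w-unifier V BF∈V)
... | zero , M≽v | zero , M≽w =
  uncurry restrict-vw-has-no-section (common-bound⇒section V BF∈V (M zero) M≽v M≽w)
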